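{- If $G$ is a connected identifiable graph on at least three vertices, then $\gamma_t^{\mathrm{L}}(G)\leq\gamma_t^{\mathrm{ID}}(G)\leq 2\gamma_t^{\mathrm{L}}(G)$.
   Context: All graphs are finite, simple and undirected. $N[v]$ is the closed neighbourhood of $v$; for $C\subseteq V(G)$, $I(v)=N[v]\cap C$. A locating-dominating set is a dominating set $C$ such that $I(u)\neq I(v)$ for all distinct $u,v\notin C$. A locating-total dominating set is a locating-dominating set such that every vertex has a neighbour in $C$; $\gamma_t^{\mathrm{L}}(G)$ is its minimum size. A total dominating identifying code is a set $C$ with $I(u)\neq I(v)$ for all distinct vertices $u,v$ and such that every vertex has a neighbour in $C$; $\gamma_t^{\mathrm{ID}}(G)$ is its minimum size. A graph is identifiable if it has no distinct $u,v$ with $N[u]=N[v]$. -}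

module Defs where

open import Data.Nat using (ℕ; _≤_; _*_)
open import Data.Fin using (Fin)
open import Data.Fin.Subset using (Subset; _∈_; _∉_; ∣_∣)
open import Data.Product using (Σ; ∃; _×_; _,_)
open import Relation.Binary.PropositionalEquality using (_≡_)
open import Relation.Nullary using (¬_)
open import Data.Sum using (_⊎_)

record Graph (n : ℕ) : Set₁ where
  field
    Adj   : Fin n → Fin n → Set
    sym   : ∀ {u v} → Adj u v → Adj v u
    irrefl : ∀ {v} → ¬ Adj v v
open Graph public

module _ {n : ℕ} (G : Graph n) where

  InN : Fin n → Fin n → Set
  InN v u = (u ≡ v) ⊎ Adj G v u

  data Reach : Fin n → Fin n → Set where
    here : ∀ {v} → Reach v v
    step : ∀ {u v w} → Adj G u v → Reach v w → Reach u w

  Connected : Set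
  Connected = ∀ u v → Reach u v

  Identifiable : Set
  Identifiable = ∀ u v → ¬ (u ≡ v) → ¬ (∀ w → (InN u w → InN v w) × (InN v w → InN u w))

  -- I(v) = N[v] ∩ C ; equality of I(u), I(v) as subsets
  SameI : Subset n → Fin n → Fin n → Set
  SameI C u v = ∀ w → w ∈ C → (InN u w → InN v w) × (InN v w → InN u w)

  Dominating : Subset n → Set
  Dominating C = ∀ v → ∃ λ w → w ∈ C × InN v w

  TotalDominating : Subset n → Set
  TotalDominating C = ∀ v → ∃ λ w → w ∈ C × Adj G v w

  LocatingDominating : Subset n → Set
  LocatingDominating C =
    Dominating C × (∀ u v → u ∉ C → v ∉ C → ¬ (u ≡ v) → ¬ SameI C u v)

  LocatingTotalDominating : Subset n → Set
  LocatingTotalDominating C = LocatingDominating C × TotalDominating C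

  TotalDominatingIdentifying : Subset n → Set
  TotalDominatingIdentifying C =
    (∀ u v → ¬ (u ≡ v) → ¬ SameI C u v) × TotalDominating C

  IsMinimum : (Subset n → Set) → Subset n → Set
  IsMinimum P C = P C × (∀ D → P D → ∣ C ∣ ≤ ∣ D ∣)

  γtL≡ : ℕ → Set
  γtL≡ k = ∃ λ C → IsMinimum LocatingTotalDominating C × ∣ C ∣ ≡ k

  γtID≡ : ℕ → Set
  γtID≡ k = ∃ λ C → IsMinimum TotalDominatingIdentifying C × ∣ C ∣ ≡ k

{-# OPTIONS --safe #-}

-- Every total-dominating identifying code is locating-total-dominating, which gives the lower
-- bound. For the upper bound, start from a locating-total-dominating set C and, while two
-- vertices u ≠ v still have equal traces I(u) = I(v), add a vertex of N[u] △ N[v] (which exists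
-- by identifiability). The potential is the number of vertices that are not the least of their
-- trace class, for a ranking that puts C last: adding such a vertex strictly refines the classes
-- and so lowers it, and it starts at most |C|, since by the locating property every class has at
-- most one vertex outside C and that vertex is its least. So at most |C| vertices are added.
-- Adjacency is not assumed decidable, but the conclusion is, so the construction may run under a
-- double negation.
module Submission where

open import Defs
open import Data.Bool.Properties using (T-≡)
open import Data.Empty using (⊥-elim)
open import Data.Fin using (Fin; zero; suc; toℕ; _≟_)
open import Data.Fin.Properties using (toℕ<n; toℕ-injective; any?; all?; ∀-cons; ¬∀⟶∃¬)
open import Data.Fin.Subset using (Subset; _∈_; _∉_; ∣_∣; _⊆_; _∪_; ⁅_⁆; inside; outside)
open import Data.Fin.Subset.Properties
  using (_∈?_; x∈⁅x⁆; ∣⁅x⁆∣≡1; p⊆p∪q; x∈p∪q⁺; ∣p∣≤∣x∷p∣; p⊆q⇒∣p∣≤∣q∣; p⊂q⇒∣p∣<∣q∣)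
open import Data.Nat as ℕ using (ℕ; _≤_; _<_; _+_; _*_; z≤n; s≤s; _≤?_; _<?_)
open import Data.Nat.Induction using (<-wellFounded)
open import Data.Nat.Properties
  using (≤-trans; ≤-reflexive; <-irrefl; <-asym; <⇒≱; ≮⇒≥; ≤∧≢⇒<; m≤m+n; +-suc; +-comm; +-identityʳ;
         +-cancelˡ-≡; +-monoˡ-≤; +-monoʳ-≤; module ≤-Reasoning)
open import Data.Product using (∃; ∃₂; _×_; _,_; proj₁; proj₂)
open import Data.Sum using (inj₂)
open import Data.Vec using ([]; _∷_; tabulate)
open import Data.Vec.Properties using (lookup∘tabulate; lookup⇒[]=; []=⇒lookup)
open import Function using (_∘_; id)
open import Function.Bundles using (Equivalence)
open import Function.Definitions using (Injective)
open import Induction.WellFounded using (Acc; acc)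
open import Level using (Level; 0ℓ)
open import Relation.Binary.Core using (Rel; _⇒_)
open import Relation.Binary.Definitions using (Decidable)
open import Relation.Binary.PropositionalEquality using (_≡_; _≢_; refl; cong; subst) renaming (sym to ≡-sym; trans to ≡-trans)
open import Relation.Binary.Structures using (IsDecEquivalence)
open import Relation.Nullary using (¬_; Dec; yes; no)
open import Relation.Nullary.Decidable
  using (isYes; toWitness; fromWitness; decidable-stable; ¬¬-excluded-middle; ¬?; _×-dec_; _⊎-dec_; _→-dec_)
open import Relation.Nullary.Negation using (¬¬-map)
open import Relation.Unary as U using (Pred)
open Equivalence using (to; from)

private
  variable
    ℓ : Level
    n : ℕ

∣p∪q∣≤∣p∣+∣q∣ : (p q : Subset n) → ∣ p ∪ q ∣ ≤ ∣ p ∣ + ∣ q ∣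
∣p∪q∣≤∣p∣+∣q∣ []            []       = z≤n
∣p∪q∣≤∣p∣+∣q∣ (inside  ∷ p) (s ∷ q)  = s≤s (≤-trans (∣p∪q∣≤∣p∣+∣q∣ p q) (+-monoʳ-≤ ∣ p ∣ (∣p∣≤∣x∷p∣ s q)))
∣p∪q∣≤∣p∣+∣q∣ (outside ∷ p) (inside  ∷ q) =
  ≤-trans (s≤s (∣p∪q∣≤∣p∣+∣q∣ p q)) (≤-reflexive (≡-sym (+-suc ∣ p ∣ ∣ q ∣)))
∣p∪q∣≤∣p∣+∣q∣ (outside ∷ p) (outside ∷ q) = ∣p∪q∣≤∣p∣+∣q∣ p q

∣p∪⁅x⁆∣≤1+∣p∣ : (p : Subset n) (x : Fin n) → ∣ p ∪ ⁅ x ⁆ ∣ ≤ 1 + ∣ p ∣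
∣p∪⁅x⁆∣≤1+∣p∣ p x = ≤-trans (∣p∪q∣≤∣p∣+∣q∣ p ⁅ x ⁆)
  (≤-reflexive (≡-trans (cong (∣ p ∣ +_) (∣⁅x⁆∣≡1 x)) (+-comm ∣ p ∣ 1)))

module _ {P : Pred (Fin n) ℓ} (P? : U.Decidable P) where

  toSubset : Subset n
  toSubset = tabulate (isYes ∘ P?)

  ∈-toSubset⁺ : ∀ {x} → P x → x ∈ toSubset
  ∈-toSubset⁺ {x} Px = lookup⇒[]= x toSubset (≡-trans (lookup∘tabulate _ x) (T-≡ .to (fromWitness Px)))

  ∈-toSubset⁻ : ∀ {x} → x ∈ toSubset → P x
  ∈-toSubset⁻ {x} x∈ = toWitness (T-≡ .from (≡-trans (≡-sym (lookup∘tabulate _ x)) ([]=⇒lookup x∈)))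

¬¬-pull-Fin : ∀ m {P : Pred (Fin m) ℓ} → (∀ i → ¬ ¬ P i) → ¬ ¬ (∀ i → P i)
¬¬-pull-Fin ℕ.zero    ¬¬P ¬∀P = ¬∀P λ ()
¬¬-pull-Fin (ℕ.suc m) ¬¬P ¬∀P =
  ¬¬P zero λ P₀ → ¬¬-pull-Fin m (¬¬P ∘ suc) λ P₊ → ¬∀P (∀-cons P₀ P₊)

module LeastRepresentatives (rank : Fin n → ℕ) (rank-injective : Injective _≡_ _≡_ rank) where

  least : {P : Pred (Fin n) ℓ} → U.Decidable P → ∀ {x} → P x →
          ∃ λ m → P m × (∀ {y} → P y → rank m ≤ rank y)
  least {P = P} P? {x} Px = go x Px (<-wellFounded (rank x))
    where
    go : ∀ x → P x → Acc _<_ (rank x) → ∃ λ m → P m × (∀ {y} → P y → rank m ≤ rank y)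
    go x Px (acc smaller) with any? (λ y → P? y ×-dec rank y <? rank x)
    ... | yes (y , Py , y<x) = go y Py (smaller y<x)
    ... | no ∄smaller        = x , Px , λ {y} Py → ≮⇒≥ (λ y<x → ∄smaller (y , Py , y<x))

  module _ {_≈_ : Rel (Fin n) 0ℓ} (_≈?_ : Decidable _≈_) where

    NonLeast : Pred (Fin n) 0ℓ
    NonLeast x = ∃ λ y → rank y < rank x × y ≈ x

    nonLeast : Subset n
    nonLeast = toSubset (λ x → any? (λ y → rank y <? rank x ×-dec y ≈? x))

    nonLeast⊆ : (C : Subset n) → (∀ {u v} → u ∉ C → v ∉ C → u ≈ v → u ≡ v) →
                (∀ {u v} → u ∉ C → v ∈ C → rank u < rank v) → nonLeast ⊆ C
    nonLeast⊆ C separated ranked {x} x∈ with ∈-toSubset⁻ _ x∈ | x ∈? C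
    ... | _              | yes x∈C = x∈C
    ... | y , y<x , y≈x | no x∉C with y ∈? C
    ...   | yes y∈C = ⊥-elim (<-asym (ranked x∉C y∈C) y<x)
    ...   | no y∉C  = ⊥-elim (<-irrefl (cong rank (separated y∉C x∉C y≈x)) y<x)

  refinement-shrinks-nonLeast :
    {_≈_ _≈′_ : Rel (Fin n) 0ℓ} (≈-isDec : IsDecEquivalence _≈_) (≈′-isDec : IsDecEquivalence _≈′_) →
    _≈′_ ⇒ _≈_ → ∀ {u v} → u ≈ v → ¬ u ≈′ v →
    ∣ nonLeast (IsDecEquivalence._≟_ ≈′-isDec) ∣ < ∣ nonLeast (IsDecEquivalence._≟_ ≈-isDec) ∣
  refinement-shrinks-nonLeast {_≈_ = _≈_} {_≈′_} ≈-isDec ≈′-isDec ≈′⇒≈ {u} {v} u≈v u≉′v =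
    p⊂q⇒∣p∣<∣q∣ (coarser , separated-witness)
    where
    module ≈ = IsDecEquivalence ≈-isDec
    module ≈′ = IsDecEquivalence ≈′-isDec

    coarser : nonLeast ≈′._≟_ ⊆ nonLeast ≈._≟_
    coarser x∈ with ∈-toSubset⁻ _ x∈
    ... | y , y<x , y≈′x = ∈-toSubset⁺ _ (y , y<x , ≈′⇒≈ y≈′x)

    class-splits : ∀ m → m ≈ u → ∃ λ t → t ≈ m × ¬ t ≈′ m
    class-splits m m≈u with u ≈′.≟ m | v ≈′.≟ m
    ... | no u≉′m | _       = u , ≈.sym m≈u , u≉′m
    ... | yes u≈′m | no v≉′m = v , ≈.trans (≈.sym u≈v) (≈.sym m≈u) , v≉′m
    ... | yes u≈′m | yes v≈′m = ⊥-elim (u≉′v (≈′.trans u≈′m (≈′.sym v≈′m)))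

    -- With m least in the class of u, the least x of that class split off from m by ≈′
    -- is non-least for ≈ (behind m) but least in its ≈′-class.
    separated-witness : ∃ λ x → x ∈ nonLeast ≈._≟_ × x ∉ nonLeast ≈′._≟_
    separated-witness with least (λ y → y ≈.≟ u) {u} ≈.refl
    ... | m , m≈u , m-least with class-splits m m≈u
    ... | t , t≈m , t≉′m with least (λ y → y ≈.≟ m ×-dec ¬? (y ≈′.≟ m)) (t≈m , t≉′m)
    ... | x , (x≈m , x≉′m) , x-least =
      x , ∈-toSubset⁺ _ (m , m<x , ≈.sym x≈m) , x-least′ ∘ ∈-toSubset⁻ _
      where
      m<x : rank m < rank x
      m<x = ≤∧≢⇒< (m-least (≈.trans x≈m m≈u)) λ eq → x≉′m (≈′.reflexive (≡-sym (rank-injective eq)))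

      x-least′ : ¬ NonLeast ≈′._≟_ x
      x-least′ (y , y<x , y≈′x) =
        <⇒≱ y<x (x-least (≈.trans (≈′⇒≈ y≈′x) x≈m , λ y≈′m → x≉′m (≈′.trans (≈′.sym y≈′x) y≈′m)))

module _ (C : Subset n) where

  rankLast : Fin n → ℕ
  rankLast v with v ∈? C
  ... | yes _ = n + toℕ v
  ... | no _  = toℕ v

  rankLast-injective : Injective _≡_ _≡_ rankLast
  rankLast-injective {u} {v} eq with u ∈? C | v ∈? C
  ... | yes _ | yes _ = toℕ-injective (+-cancelˡ-≡ n _ _ eq)
  ... | no _  | no _  = toℕ-injective eq
  ... | yes _ | no _  = ⊥-elim (<⇒≱ (toℕ<n v) (subst (n ≤_) eq (m≤m+n n (toℕ u))))
  ... | no _  | yes _ = ⊥-elim (<⇒≱ (toℕ<n u) (subst (n ≤_) (≡-sym eq) (m≤m+n n (toℕ v))))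

  rankLast-∉<∈ : ∀ {u v} → u ∉ C → v ∈ C → rankLast u < rankLast v
  rankLast-∉<∈ {u} {v} u∉C v∈C with u ∈? C | v ∈? C
  ... | yes u∈C | _      = ⊥-elim (u∉C u∈C)
  ... | no _    | no v∉C = ⊥-elim (v∉C v∈C)
  ... | no _    | yes _  = ≤-trans (toℕ<n u) (m≤m+n n (toℕ v))

module _ (G : Graph n) where

  Separating : Subset n → Set
  Separating F = ∀ u v → u ≢ v → ¬ SameI G F u v

  SeparatingSuperset : Subset n → ℕ → Set
  SeparatingSuperset E k = ∃ λ F → E ⊆ F × Separating F × ∣ F ∣ ≤ ∣ E ∣ + k

  SameI-antitone : ∀ {E F} → E ⊆ F → SameI G F ⇒ SameI G E
  SameI-antitone E⊆F uv w w∈E = uv w (E⊆F w∈E)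

  totalDominating-⊆ : ∀ {C F} → C ⊆ F → TotalDominating G C → TotalDominating G F
  totalDominating-⊆ C⊆F td v with td v
  ... | w , w∈C , vw = w , C⊆F w∈C , vw

  totalDominatingIdentifying⇒locatingTotalDominating :
    ∀ {C} → TotalDominatingIdentifying G C → LocatingTotalDominating G C
  totalDominatingIdentifying⇒locatingTotalDominating (separating , td) =
    ((λ v → let (w , w∈C , vw) = td v in w , w∈C , inj₂ vw) , (λ u v _ _ → separating u v)) , td

  module _ (adj? : ∀ u v → Dec (Adj G u v)) where

    InN? : ∀ v u → Dec (InN G v u)
    InN? v u = (u ≟ v) ⊎-dec adj? v u

    SameAt? : ∀ u v w → Dec ((InN G u w → InN G v w) × (InN G v w → InN G u w))
    SameAt? u v w = (InN? u w →-dec InN? v w) ×-dec (InN? v w →-dec InN? u w)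

    SameI-isDecEquivalence : ∀ E → IsDecEquivalence (SameI G E)
    SameI-isDecEquivalence E = record
      { isEquivalence = record
        { refl  = λ _ _ → id , id
        ; sym   = λ uv w w∈E → proj₂ (uv w w∈E) , proj₁ (uv w w∈E)
        ; trans = λ uv vt w w∈E → proj₁ (vt w w∈E) ∘ proj₁ (uv w w∈E) , proj₂ (uv w w∈E) ∘ proj₂ (vt w w∈E)
        }
      ; _≟_ = λ u v → all? λ w → (w ∈? E) →-dec SameAt? u v w
      }

    SameI? : ∀ E → Decidable (SameI G E)
    SameI? E = IsDecEquivalence._≟_ (SameI-isDecEquivalence E)

    twins? : ∀ E → Dec (∃₂ λ u v → u ≢ v × SameI G E u v)
    twins? E = any? λ u → any? λ v → ¬? (u ≟ v) ×-dec SameI? E u v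

    distinguisher : Identifiable G → ∀ {u v} → u ≢ v → ∃ λ w → ∀ {E} → w ∈ E → ¬ SameI G E u v
    distinguisher identifiable {u} {v} u≢v with ¬∀⟶∃¬ n _ (SameAt? u v) (identifiable u v u≢v)
    ... | w , differ = w , λ w∈E uv → differ (uv w w∈E)

    module Greedy (rank : Fin n → ℕ) (rank-injective : Injective _≡_ _≡_ rank) where
      open LeastRepresentatives rank rank-injective

      surplus : Subset n → ℕ
      surplus E = ∣ nonLeast (SameI? E) ∣

      distinguishing-shrinks-surplus : ∀ {E u v w} → SameI G E u v → (∀ {F} → w ∈ F → ¬ SameI G F u v) →
                                       surplus (E ∪ ⁅ w ⁆) < surplus E
      distinguishing-shrinks-surplus {E} {w = w} uv w-separates =
        refinement-shrinks-nonLeast (SameI-isDecEquivalence E) (SameI-isDecEquivalence (E ∪ ⁅ w ⁆))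
          (SameI-antitone (p⊆p∪q ⁅ w ⁆)) uv (w-separates (x∈p∪q⁺ (inj₂ (x∈⁅x⁆ w))))

      separatingSuperset-∪⁅⁆ : ∀ {E w} → surplus (E ∪ ⁅ w ⁆) < surplus E →
                               SeparatingSuperset (E ∪ ⁅ w ⁆) (surplus (E ∪ ⁅ w ⁆)) →
                               SeparatingSuperset E (surplus E)
      separatingSuperset-∪⁅⁆ {E} {w} shrinks (F , E∪w⊆F , separating , ∣F∣≤) =
        F , E∪w⊆F ∘ p⊆p∪q ⁅ w ⁆ , separating , (begin
          ∣ F ∣                                 ≤⟨ ∣F∣≤ ⟩
          ∣ E ∪ ⁅ w ⁆ ∣ + surplus (E ∪ ⁅ w ⁆)   ≤⟨ +-monoˡ-≤ (surplus (E ∪ ⁅ w ⁆)) (∣p∪⁅x⁆∣≤1+∣p∣ E w) ⟩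
          ℕ.suc ∣ E ∣ + surplus (E ∪ ⁅ w ⁆)     ≡⟨ ≡-sym (+-suc ∣ E ∣ (surplus (E ∪ ⁅ w ⁆))) ⟩
          ∣ E ∣ + ℕ.suc (surplus (E ∪ ⁅ w ⁆))   ≤⟨ +-monoʳ-≤ ∣ E ∣ shrinks ⟩
          ∣ E ∣ + surplus E                     ∎)
        where open ≤-Reasoning

      separatingSuperset : Identifiable G → ∀ E → SeparatingSuperset E (surplus E)
      separatingSuperset identifiable E = go E (<-wellFounded (surplus E))
        where
        go : ∀ E → Acc _<_ (surplus E) → SeparatingSuperset E (surplus E)
        go E (acc smaller) with twins? E
        ... | no ∄twins = E , id , (λ u v u≢v uv → ∄twins (u , v , u≢v , uv)) , m≤m+n _ _
        ... | yes (u , v , u≢v , uv) =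
          let w , w-separates = distinguisher identifiable u≢v
              shrinks = distinguishing-shrinks-surplus uv w-separates
          in separatingSuperset-∪⁅⁆ shrinks (go (E ∪ ⁅ w ⁆) (smaller shrinks))

    locating⇒identifying-≤2* : Identifiable G → ∀ {C} → LocatingTotalDominating G C →
                                ∃ λ F → TotalDominatingIdentifying G F × ∣ F ∣ ≤ 2 * ∣ C ∣
    locating⇒identifying-≤2* identifiable {C} ((_ , locating) , td) =
      let F , C⊆F , separating , ∣F∣≤ = separatingSuperset identifiable C
      in F , (separating , totalDominating-⊆ C⊆F td) , (begin
        ∣ F ∣                ≤⟨ ∣F∣≤ ⟩
        ∣ C ∣ + surplus C    ≤⟨ +-monoʳ-≤ ∣ C ∣ (p⊆q⇒∣p∣≤∣q∣ (nonLeast⊆ (SameI? C) C separated (rankLast-∉<∈ C))) ⟩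
        ∣ C ∣ + ∣ C ∣        ≡⟨ cong (∣ C ∣ +_) (≡-sym (+-identityʳ ∣ C ∣)) ⟩
        2 * ∣ C ∣            ∎)
      where
      open ≤-Reasoning
      open LeastRepresentatives (rankLast C) (rankLast-injective C)
      open Greedy (rankLast C) (rankLast-injective C)
      separated : ∀ {u v} → u ∉ C → v ∉ C → SameI G C u v → u ≡ v
      separated {u} {v} u∉C v∉C uv with u ≟ v
      ... | yes u≡v = u≡v
      ... | no u≢v  = ⊥-elim (locating u v u∉C v∉C u≢v uv)

  ¬¬-decidable-adjacency : ¬ ¬ (∀ u v → Dec (Adj G u v))
  ¬¬-decidable-adjacency = ¬¬-pull-Fin n λ u → ¬¬-pull-Fin n λ v → ¬¬-excluded-middle

theorem18 : (n : ℕ) → (G : Graph n) → 3 ≤ n → Connected G → Identifiable G →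
    (a b : ℕ) → γtL≡ G a → γtID≡ G b → (a ≤ b) × (b ≤ 2 * a)
-- Connectivity and 3 ≤ n only serve to make both parameters exist, which γtL≡ and γtID≡ assert.
theorem18 n G _ _ identifiable _ _ (C , (ltdC , minC) , refl) (D , (tdiD , minD) , refl) =
  minC D (totalDominatingIdentifying⇒locatingTotalDominating G tdiD) ,
  decidable-stable (∣ D ∣ ≤? 2 * ∣ C ∣) (¬¬-map upper-bound (¬¬-decidable-adjacency G))
  where
  upper-bound : (∀ u v → Dec (Adj G u v)) → ∣ D ∣ ≤ 2 * ∣ C ∣
  upper-bound adj? with locating⇒identifying-≤2* G adj? identifiable ltdC
  ... | F , tdiF , ∣F∣≤ = ≤-trans (minD F tdiF) ∣F∣≤
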